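{- Let $k\ge1$ and let $M_{st}=(m_{ij})_{1\le i,j\le k}$ be the path matrix of the triangular snake graph $\mathcal{T}_{L_{2k-1}}$ of the vertical ladder graph $L_{2k-1}$ (between its sources $s$ and sinks $t$). Then \[ m_{ij}=\begin{cases} F_3=2 & \text{if } i=j=1,\\ F_4=3 & \text{if } i=j\in\{2,\dots,k\},\\ F_2=1 & \text{if } i=j+1 \text{ or } i=j-1,\\ F_0=0 & \text{otherwise},\end{cases} \] and $\det M_{st}=F_{2k+1}$.
   Context: $F_n$ is the $n$-th Fibonacci number ($F_0=0$, $F_1=1$, $F_{n+1}=F_n+F_{n-1}$). The vertical ladder graph $L_n$ is the snake graph consisting of $n$ unit-square tiles $G_1,\dots,G_n$ stacked vertically, $G_{i+1}$ immediately above $G_i$ (north edge of $G_i$ = south edge of $G_{i+1}$). Its triangular snake graph $\mathcal{T}_{L_n}$: for odd $i$ let $c_i$ be the north edge of $G_i$, for even $i$ the south edge; contract each $c_i$ to a vertex $\mathbf{c}_i$ (with the $y$-coordinate of $c_i$) and orient remaining edges: for odd $i$, with $a,b$ the south-west and south-east corners of $G_i$, arrows $a\to b$, $a\to\mathbf{c}_i$ (west edge), $\mathbf{c}_i\to b$ (east edge); for even $i$, with $a,b$ the north-west and north-east corners, arrows $a\to b$, $a\to\mathbf{c}_i$, $\mathbf{c}_i\to b$. Sources/sinks (vertices with no incoming/outgoing arrows) are listed as $s=(s_1,\dots,s_k)$, $t=(t_1,\dots,t_k)$ in order of increasing $y$-coordinate. The path matrix entry $m_{ij}$ is the number of directed paths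 from $s_i$ to $t_j$. -}

module Defs where

open import Data.Bool using (Bool; true; false; if_then_else_; _∧_; _∨_; not; T)
open import Data.Nat using (ℕ; zero; suc; _+_; _∸_; _≡ᵇ_)
open import Data.Product using (_×_; _,_)
open import Data.List using (List; []; _∷_; _++_; map; upTo; filterᵇ; concatMap)
open import Data.Bool.ListAction using (any)
open import Data.Fin using (Fin; zero; suc; toℕ; punchIn)
open import Data.Integer as ℤ using (ℤ; +_; -_)

fib : ℕ → ℕ
fib zero          = 0
fib (suc zero)    = 1
fib (suc (suc n)) = fib (suc n) + fib n

sumℤ : ∀ {n} → (Fin n → ℤ) → ℤ
sumℤ {zero}  f = + 0
sumℤ {suc n} f = f zero ℤ.+ sumℤ (λ j → f (suc j))

sign : ∀ {n} → Fin n → ℤ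
sign zero    = + 1
sign (suc j) = - sign j

det : ∀ {n} → (Fin n → Fin n → ℤ) → ℤ
det {zero}  A = + 1
det {suc n} A =
  sumℤ (λ j → sign j ℤ.* A zero j ℤ.* det (λ r c → A (suc r) (punchIn j c)))

-- Grid vertices are pairs (x , y) with x = false (west, x-coordinate 0)
-- or x = true (east, x-coordinate 1) and y ∈ {0,…,n}.
-- Tile G_i (1 ≤ i ≤ n) has corners (W,i-1),(E,i-1),(W,i),(E,i).

V : Set
V = Bool × ℕ

W E : Bool
W = false
E = true

odd : ℕ → Bool
odd zero    = false
odd (suc n) = not (odd n)

_==V_ : V → V → Bool
(x , y) ==V (x' , y') = (if x then x' else not x') ∧ (y ≡ᵇ y')

tiles : ℕ → List ℕ
tiles n = map suc (upTo n)

-- y-coordinate of the contracted edge c_i: north edge (y = i) for odd i,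
-- south edge (y = i - 1) for even i
cHeight : ℕ → ℕ
cHeight i = if odd i then i else i ∸ 1

contracted : ℕ → ℕ → Bool
contracted n y = any (λ i → cHeight i ≡ᵇ y) (tiles n)

-- canonical representative of a vertex after contraction: a contracted
-- horizontal edge at height y becomes the single vertex (W , y)
canon : ℕ → V → V
canon n (x , y) = if contracted n y then (W , y) else (x , y)

vertices : ℕ → List V
vertices n = concatMap (λ y → if contracted n y then (W , y) ∷ []
                                                else (W , y) ∷ (E , y) ∷ [])
                       (upTo (suc n))

tileArrows : ℕ → ℕ → List (V × V)
tileArrows n i =
  if odd i
  then arrs (canon n (W , i ∸ 1)) (canon n (E , i ∸ 1)) (canon n (W , i))
  else arrs (canon n (W , i)) (canon n (E , i)) (canon n (W , i ∸ 1))
  where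
  arrs : V → V → V → List (V × V)
  arrs a b c = (a , b) ∷ (a , c) ∷ (c , b) ∷ []

arrow : ℕ → V → V → Bool
arrow n u v = any (λ i → any (λ { (a , b) → (a ==V u) ∧ (b ==V v) })
                             (tileArrows n i))
                  (tiles n)

-- directed paths u ⇝ v in T_{L_n} (T_{L_n} is acyclic, so these are
-- exactly the directed paths)
data Path (n : ℕ) : V → V → Set where
  here : ∀ {v} → Path n v v
  step : ∀ {u w v} → T (arrow n u w) → Path n w v → Path n u v

-- sources / sinks, in order of increasing y-coordinate
isSource : ℕ → V → Bool
isSource n v = not (any (λ u → arrow n u v) (vertices n))

isSink : ℕ → V → Bool
isSink n v = not (any (λ w → arrow n v w) (vertices n))

sources : ℕ → List V
sources n = filterᵇ (isSource n) (vertices n)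

sinks : ℕ → List V
sinks n = filterᵇ (isSink n) (vertices n)

-- The claimed entries m_ij (indices 0-based here: index 0 is i = 1)

claimedEntry : ∀ {k} → Fin k → Fin k → ℕ
claimedEntry i j =
  if toℕ i ≡ᵇ toℕ j
  then (if toℕ i ≡ᵇ 0 then fib 3 else fib 4)
  else (if (suc (toℕ i) ≡ᵇ toℕ j) ∨ (toℕ i ≡ᵇ suc (toℕ j))
        then fib 2 else fib 0)

-- In T_{L_{2k-1}} exactly the odd heights 2i+1 are contracted, so for 0 ≤ i < k the vertices
-- are s_i = (W,2i), t_i = (E,2i) and one contracted vertex c_i = (W,2i+1), and the arrows are
-- s_i → t_i, s_i → c_i, c_i → t_i (tile 2i+1) and s_{i+1} → c_i, c_i → t_{i+1} (tile 2i+2).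
-- The s_i are the sources and the t_i the sinks, and a path s_a ⇝ t_b is either the arrow
-- s_a → t_b or passes through c_a or c_{a-1}; counting these gives the tridiagonal entries.
-- Expanding the determinant along the first row gives the continuant recurrence
-- D_{m+2} = 3 D_{m+1} - D_m, which is the recurrence of the even-indexed Fibonacci numbers.
module Submission where

open import Defs
open import Axiom.UniquenessOfIdentityProofs.WithK using (uip)
open import Data.Bool using (Bool; true; false; if_then_else_; _∧_; _∨_; not; T)
open import Data.Bool.Properties using (T-irrelevant; T-∧; T-not-≡; T-≡; not-involutive)
open import Data.Bool.ListAction using (any)
open import Data.Empty using (⊥; ⊥-elim)
open import Data.Fin using (Fin; zero; suc; toℕ; punchIn; cast)
open import Data.Fin.Properties using (toℕ<n; toℕ-cast; 0↔⊥; 1↔⊤; +↔⊎)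
open import Data.Integer as ℤ using (ℤ; +_; -_; 0ℤ)
import Data.Integer.Properties as ℤ
open import Data.Integer.Tactic.RingSolver as ℤ-Solver using ()
open import Data.List using (List; []; _∷_; _++_; map; concat; concatMap; applyUpTo; upTo; filterᵇ; length; lookup)
open import Data.List.Membership.Propositional using (_∈_; lose; find)
open import Data.List.Membership.Propositional.Properties using (Any↔; ∈-upTo⁺; ∈-upTo⁻; ∈-concatMap⁺)
open import Data.List.Membership.Propositional.Properties.WithK using (unique⇒irrelevant)
open import Data.List.Properties using (++-assoc; filter-++; filter-accept; filter-reject; length-applyUpTo; lookup-applyUpTo)
open import Data.List.Relation.Unary.All using ([]; _∷_)
open import Data.List.Relation.Unary.Any as Any using (Any; here; there; satisfied)
import Data.List.Relation.Unary.Any.Properties as Anyₚ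
open import Data.List.Relation.Unary.Any.Properties using (any⁺; any⁻; ∷↔; ⊥↔Any[]; singleton⁺; singleton⁻)
open import Data.List.Relation.Unary.Unique.Propositional using (Unique)
open import Data.List.Relation.Unary.AllPairs using ([]; _∷_)
open import Data.Nat using (ℕ; zero; suc; _+_; _*_; _∸_; _≤_; _<_; z≤n; s≤s; z<s; s<s; _≡ᵇ_)
open import Data.Nat.Properties using (≤-pred; <⇒≤; suc-injective; 1+n≢n; ≡ᵇ⇒≡; ≡⇒≡ᵇ; ≡-irrelevant; *-suc)
open import Data.Nat.Tactic.RingSolver as ℕ-Solver using ()
open import Data.Product using (Σ; ∃; _×_; _,_; proj₁; proj₂)
open import Data.Sum.Function.Propositional using (_⊎-↔_)
open import Data.Unit using (tt)
open import Function using (_∘_; id)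
open import Function.Bundles using (_↔_; _⇔_; mk↔ₛ′; mk⇔; Equivalence; Inverse)
open import Function.Properties.Inverse using (↔-sym; ↔-trans)
open import Relation.Binary.PropositionalEquality
open import Relation.Nullary using (¬_; Irrelevant)
open import Relation.Nullary.Decidable using (T?)

double : ℕ → ℕ
double zero    = 0
double (suc m) = suc (suc (double m))

data Parity : ℕ → Set where
  twice   : ∀ m → Parity (double m)
  twice+1 : ∀ m → Parity (suc (double m))

parity : ∀ n → Parity n
parity zero = twice 0
parity (suc n) with parity n
... | twice m   = twice+1 m
... | twice+1 m = twice (suc m)

double≡2* : ∀ m → double m ≡ 2 * m
double≡2* zero    = refl
double≡2* (suc m) = trans (cong (λ x → suc (suc x)) (double≡2* m)) (sym (*-suc 2 m))

double-injective : ∀ {a b} → double a ≡ double b → a ≡ b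
double-injective {zero}  {zero}  _ = refl
double-injective {suc a} {suc b} e = cong suc (double-injective (suc-injective (suc-injective e)))

double≢1+double : ∀ a b → double a ≢ suc (double b)
double≢1+double (suc a) (suc b) e = double≢1+double a b (suc-injective (suc-injective e))

double-mono-≤ : ∀ {a b} → a ≤ b → double a ≤ double b
double-mono-≤ z≤n       = z≤n
double-mono-≤ (s≤s a≤b) = s≤s (s≤s (double-mono-≤ a≤b))

double-cancel-≤ : ∀ {a b} → double a ≤ double b → a ≤ b
double-cancel-≤ {zero}          _                 = z≤n
double-cancel-≤ {suc a} {suc b} (s≤s (s≤s a≤b)) = s≤s (double-cancel-≤ a≤b)

double-cancel-< : ∀ {a b} → double a < double b → a < b
double-cancel-< {zero}  {suc b} _                 = z<s
double-cancel-< {suc a} {suc b} (s≤s (s≤s a<b)) = s<s (double-cancel-< a<b)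

-- Determinants

sumℤ-zero : ∀ {n} {f : Fin n → ℤ} → (∀ j → f j ≡ 0ℤ) → sumℤ f ≡ 0ℤ
sumℤ-zero {zero}  f≡0 = refl
sumℤ-zero {suc n} f≡0 = cong₂ ℤ._+_ (f≡0 zero) (sumℤ-zero (f≡0 ∘ suc))

minor₀₀ : ∀ {n} → (Fin (suc n) → Fin (suc n) → ℤ) → Fin n → Fin n → ℤ
minor₀₀ A i j = A (suc i) (suc j)

laplaceTerm-zero : ∀ {n} (j : Fin n) {a : ℤ} (d : ℤ) → a ≡ 0ℤ → sign j ℤ.* a ℤ.* d ≡ 0ℤ
laplaceTerm-zero j d refl = trans (cong (ℤ._* d) (ℤ.*-zeroʳ (sign j))) (ℤ.*-zeroˡ d)

det-firstColumn : ∀ {n} (A : Fin (suc n) → Fin (suc n) → ℤ) → (∀ i → A (suc i) zero ≡ 0ℤ) →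
                  det A ≡ A zero zero ℤ.* det (minor₀₀ A)
det-minor-firstColumn : ∀ {n} (A : Fin (suc n) → Fin (suc n) → ℤ) (j : Fin n) → (∀ i → A (suc i) zero ≡ 0ℤ) →
                        det (λ r c → A (suc r) (punchIn (suc j) c)) ≡ 0ℤ

det-firstColumn A col = begin
  + 1 ℤ.* A zero zero ℤ.* det (minor₀₀ A)
    ℤ.+ sumℤ (λ j → sign (suc j) ℤ.* A zero (suc j) ℤ.* det (λ r c → A (suc r) (punchIn (suc j) c)))
    ≡⟨ cong₂ ℤ._+_ (cong (ℤ._* det (minor₀₀ A)) (ℤ.*-identityˡ (A zero zero)))
                   (sumℤ-zero (λ j → trans (cong (sign (suc j) ℤ.* A zero (suc j) ℤ.*_)
                                                  (det-minor-firstColumn A j col))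
                                            (ℤ.*-zeroʳ (sign (suc j) ℤ.* A zero (suc j))))) ⟩
  A zero zero ℤ.* det (minor₀₀ A) ℤ.+ 0ℤ
    ≡⟨ ℤ.+-identityʳ _ ⟩
  A zero zero ℤ.* det (minor₀₀ A) ∎
  where open ≡-Reasoning

-- The minor has the zero column A (suc r) zero as its first column.
det-minor-firstColumn {suc n} A j col = begin
  det M                                  ≡⟨ det-firstColumn M (col ∘ suc) ⟩
  A (suc zero) zero ℤ.* det (minor₀₀ M)  ≡⟨ cong (ℤ._* det (minor₀₀ M)) (col zero) ⟩
  0ℤ ℤ.* det (minor₀₀ M)                 ≡⟨ ℤ.*-zeroˡ (det (minor₀₀ M)) ⟩
  0ℤ                                     ∎
  where
  open ≡-Reasoning
  M : Fin (suc n) → Fin (suc n) → ℤ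
  M r c = A (suc r) (punchIn (suc j) c)

det-recurrence : ∀ {n} (A : Fin (suc (suc n)) → Fin (suc (suc n)) → ℤ) →
                 (∀ j → A zero (suc (suc j)) ≡ 0ℤ) → (∀ i → A (suc (suc i)) zero ≡ 0ℤ) →
                 det A ≡ A zero zero ℤ.* det (minor₀₀ A)
                         ℤ.- A zero (suc zero) ℤ.* A (suc zero) zero ℤ.* det (minor₀₀ (minor₀₀ A))
det-recurrence {n} A row col = begin
  + 1 ℤ.* A zero zero ℤ.* det (minor₀₀ A) ℤ.+ (- + 1 ℤ.* A zero (suc zero) ℤ.* det N ℤ.+ sumℤ rest)
    ≡⟨ cong₂ (λ x y → + 1 ℤ.* A zero zero ℤ.* det (minor₀₀ A) ℤ.+ (- + 1 ℤ.* A zero (suc zero) ℤ.* x ℤ.+ y))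
             (det-firstColumn N col) (sumℤ-zero (λ j → laplaceTerm-zero (suc (suc j)) _ (row j))) ⟩
  + 1 ℤ.* A zero zero ℤ.* det (minor₀₀ A)
    ℤ.+ (- + 1 ℤ.* A zero (suc zero) ℤ.* (A (suc zero) zero ℤ.* det (minor₀₀ (minor₀₀ A))) ℤ.+ 0ℤ)
    ≡⟨ expand (A zero zero) (A zero (suc zero)) (A (suc zero) zero) _ _ ⟩
  A zero zero ℤ.* det (minor₀₀ A) ℤ.- A zero (suc zero) ℤ.* A (suc zero) zero ℤ.* det (minor₀₀ (minor₀₀ A)) ∎
  where
  open ≡-Reasoning
  N : Fin (suc n) → Fin (suc n) → ℤ
  N r c = A (suc r) (punchIn (suc zero) c)
  rest : Fin n → ℤ
  rest j = sign (suc (suc j)) ℤ.* A zero (suc (suc j)) ℤ.* det (λ r c → A (suc r) (punchIn (suc (suc j)) c))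
  expand : ∀ a b c x y → + 1 ℤ.* a ℤ.* x ℤ.+ (- + 1 ℤ.* b ℤ.* (c ℤ.* y) ℤ.+ 0ℤ) ≡ a ℤ.* x ℤ.- b ℤ.* c ℤ.* y
  expand = ℤ-Solver.solve-∀

fib[4+m]+fib[m]≡3*fib[2+m] : ∀ m → fib (suc (suc (suc (suc m)))) + fib m ≡ 3 * fib (suc (suc m))
fib[4+m]+fib[m]≡3*fib[2+m] m = identity (fib m) (fib (suc m))
  where
  identity : ∀ a b → (((b + a) + b) + (b + a)) + a ≡ 3 * (b + a)
  identity = ℕ-Solver.solve-∀

fib[3+m]+fib[m]≡2*fib[2+m] : ∀ m → fib (suc (suc (suc m))) + fib m ≡ 2 * fib (suc (suc m))
fib[3+m]+fib[m]≡2*fib[2+m] m = identity (fib m) (fib (suc m))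
  where
  identity : ∀ a b → ((b + a) + b) + a ≡ 2 * (b + a)
  identity = ℕ-Solver.solve-∀

-- Stated in the shape det-recurrence produces for a matrix with ones beside the corner.
continuant-step : ∀ a y {x z} → x + z ≡ a * y → + a ℤ.* + y ℤ.- + 1 ℤ.* + 1 ℤ.* + z ≡ + x
continuant-step a y {x} {z} x+z≡a*y = begin
  + a ℤ.* + y ℤ.- + 1 ℤ.* + z  ≡⟨ cong₂ ℤ._-_ (sym (ℤ.pos-* a y)) (ℤ.*-identityˡ (+ z)) ⟩
  + (a * y) ℤ.- + z            ≡⟨ cong (λ m → + m ℤ.- + z) (sym x+z≡a*y) ⟩
  + (x + z) ℤ.- + z            ≡⟨ cong (ℤ._- + z) (ℤ.pos-+ x z) ⟩
  + x ℤ.+ + z ℤ.- + z          ≡⟨ cancel (+ x) (+ z) ⟩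
  + x                          ∎
  where
  open ≡-Reasoning
  cancel : ∀ i j → i ℤ.+ j ℤ.- j ≡ i
  cancel = ℤ-Solver.solve-∀

tridiag₃ : ∀ {n} → Fin n → Fin n → ℕ
tridiag₃ i j = if toℕ i ≡ᵇ toℕ j then 3
               else (if (suc (toℕ i) ≡ᵇ toℕ j) ∨ (toℕ i ≡ᵇ suc (toℕ j)) then 1 else 0)

det-tridiag₃ : ∀ n → det {n} (λ i j → + tridiag₃ i j) ≡ + fib (suc (suc (double n)))
det-tridiag₃ zero          = refl
det-tridiag₃ (suc zero)    = refl
det-tridiag₃ (suc (suc n)) = begin
  det {suc (suc n)} (λ i j → + tridiag₃ i j)
    ≡⟨ det-recurrence {n} (λ i j → + tridiag₃ i j) (λ _ → refl) (λ _ → refl) ⟩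
  + 3 ℤ.* det {suc n} (λ i j → + tridiag₃ i j) ℤ.- + 1 ℤ.* + 1 ℤ.* det {n} (λ i j → + tridiag₃ i j)
    ≡⟨ cong₂ (λ x y → + 3 ℤ.* x ℤ.- + 1 ℤ.* + 1 ℤ.* y) (det-tridiag₃ (suc n)) (det-tridiag₃ n) ⟩
  + 3 ℤ.* + fib (double (suc (suc n))) ℤ.- + 1 ℤ.* + 1 ℤ.* + fib (suc (suc (double n)))
    ≡⟨ continuant-step 3 (fib (double (suc (suc n)))) (fib[4+m]+fib[m]≡3*fib[2+m] (suc (suc (double n)))) ⟩
  + fib (suc (suc (double (suc (suc n))))) ∎
  where open ≡-Reasoning

det-claimedEntry : ∀ h → det {suc h} (λ i j → + claimedEntry i j) ≡ + fib (suc (double (suc h)))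
det-claimedEntry zero    = refl
det-claimedEntry (suc h) = begin
  det {suc (suc h)} (λ i j → + claimedEntry i j)
    -- away from the corner the claimed entries compute to those of tridiag₃
    ≡⟨ det-recurrence {h} (λ i j → + claimedEntry i j) (λ _ → refl) (λ _ → refl) ⟩
  + 2 ℤ.* det {suc h} (λ i j → + tridiag₃ i j) ℤ.- + 1 ℤ.* + 1 ℤ.* det {h} (λ i j → + tridiag₃ i j)
    ≡⟨ cong₂ (λ x y → + 2 ℤ.* x ℤ.- + 1 ℤ.* + 1 ℤ.* y) (det-tridiag₃ (suc h)) (det-tridiag₃ h) ⟩
  + 2 ℤ.* + fib (double (suc (suc h))) ℤ.- + 1 ℤ.* + 1 ℤ.* + fib (suc (suc (double h)))
    ≡⟨ continuant-step 2 (fib (double (suc (suc h)))) (fib[3+m]+fib[m]≡2*fib[2+m] (suc (suc (double h)))) ⟩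
  + fib (suc (double (suc (suc h)))) ∎
  where open ≡-Reasoning

T-not⁺ : ∀ {b} → ¬ T b → T (not b)
T-not⁺ {false} _  = tt
T-not⁺ {true}  ¬t = ⊥-elim (¬t tt)

T-not⁻ : ∀ {b} → T b → ¬ T (not b)
T-not⁻ {true} _ ()

T-any⇔∈ : ∀ {A : Set} {p : A → Bool} {y : A} → (∀ x → T (p x) ⇔ y ≡ x) →
          ∀ xs → T (any p xs) ⇔ y ∈ xs
T-any⇔∈ {p = p} p⇔ xs =
  mk⇔ (Any.map (Equivalence.to (p⇔ _)) ∘ any⁻ p xs) (any⁺ p ∘ Any.map (Equivalence.from (p⇔ _)))

applyUpTo-double : ∀ {A : Set} (f : ℕ → A) c →
                   applyUpTo f (double c) ≡ concat (applyUpTo (λ i → f (double i) ∷ f (suc (double i)) ∷ []) c)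
applyUpTo-double f zero    = refl
applyUpTo-double f (suc c) = cong (λ xs → f 0 ∷ f 1 ∷ xs) (applyUpTo-double (λ y → f (suc (suc y))) c)

filterᵇ-concatMap : ∀ {A : Set} (p : A → Bool) (B : ℕ → List A) (g : ℕ → A) c (f : ℕ → ℕ) →
                    (∀ i → i < c → filterᵇ p (B (f i)) ≡ g (f i) ∷ []) →
                    filterᵇ p (concatMap B (applyUpTo f c)) ≡ applyUpTo (g ∘ f) c
filterᵇ-concatMap p B g zero    f _    = refl
filterᵇ-concatMap p B g (suc c) f hyp =
  trans (filter-++ (T? ∘ p) (B (f 0)) _)
        (cong₂ _++_ (hyp 0 z<s) (filterᵇ-concatMap p B g c (f ∘ suc) (λ i i<c → hyp (suc i) (s<s i<c))))

lookup-cast-applyUpTo : ∀ {A : Set} {xs : List A} (f : ℕ → A) m → xs ≡ applyUpTo f m →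
                        (e : length xs ≡ m) (i : Fin m) → lookup xs (cast (sym e) i) ≡ f (toℕ i)
lookup-cast-applyUpTo f m refl e i =
  trans (lookup-applyUpTo f m (cast (sym e) i)) (cong f (toℕ-cast (sym e) i))

irrelevant-⇔⇒↔ : ∀ {A B : Set} → Irrelevant A → Irrelevant B → A ⇔ B → A ↔ B
irrelevant-⇔⇒↔ A-irr B-irr A⇔B = mk↔ₛ′ to from (λ _ → B-irr _ _) (λ _ → A-irr _ _)
  where open Equivalence A⇔B

δ : ℕ → ℕ → ℕ
δ i j = if i ≡ᵇ j then 1 else 0

≡↔Fin-δ : ∀ {i j} → (i ≡ j) ↔ Fin (δ i j)
≡↔Fin-δ {i} {j} =
  ↔-trans (irrelevant-⇔⇒↔ ≡-irrelevant T-irrelevant (mk⇔ (≡⇒≡ᵇ i j) (≡ᵇ⇒≡ i j))) (T↔Fin (i ≡ᵇ j))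
  where
  T↔Fin : ∀ b → T b ↔ Fin (if b then 1 else 0)
  T↔Fin true  = ↔-sym 1↔⊤
  T↔Fin false = ↔-sym 0↔⊥

Any-[]↔Fin : ∀ {A : Set} {P : A → Set} → Any P [] ↔ Fin 0
Any-[]↔Fin = ↔-trans (↔-sym ⊥↔Any[]) (↔-sym 0↔⊥)

Any-[x]↔ : ∀ {A : Set} {P : A → Set} {x} → Any P (x ∷ []) ↔ P x
Any-[x]↔ = mk↔ₛ′ singleton⁻ singleton⁺ (λ _ → refl) (λ { (here _) → refl })

Any-∷↔Fin : ∀ {A : Set} {P : A → Set} {x xs a b} → P x ↔ Fin a → Any P xs ↔ Fin b → Any P (x ∷ xs) ↔ Fin (a + b)
Any-∷↔Fin {P = P} px pxs = ↔-trans (↔-sym (∷↔ P)) (↔-trans (px ⊎-↔ pxs) (↔-sym +↔⊎))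

-- R only has to agree with membership in ws where X is inhabited.
Σ-neighbours↔Any : ∀ {A : Set} {R X : A → Set} (ws : List A) → Unique ws → (∀ {w} → Irrelevant (R w)) →
                   (∀ {w} → X w → R w ⇔ w ∈ ws) → (∃ λ w → R w × X w) ↔ Any X ws
Σ-neighbours↔Any {R = R} {X} ws ws-unique R-irr R⇔∈ = ↔-trans Σ↔ Any↔
  where
  Σ↔ : (∃ λ w → R w × X w) ↔ (∃ λ w → w ∈ ws × X w)
  Σ↔ = mk↔ₛ′ (λ (w , r , x) → w , Equivalence.to (R⇔∈ x) r , x)
             (λ (w , w∈ , x) → w , Equivalence.from (R⇔∈ x) w∈ , x)
             (λ (w , w∈ , x) → cong (λ w∈′ → w , w∈′ , x) (unique⇒irrelevant ws-unique _ _))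
             (λ (w , r , x) → cong (λ r′ → w , r′ , x) (R-irr _ _))

-- The triangular snake graph of a ladder

odd-double : ∀ m → odd (double m) ≡ false
odd-double zero    = refl
odd-double (suc m) = trans (not-involutive (odd (double m))) (odd-double m)

-- Tiles 2m+1 and 2m+2 are both contracted onto height 2m+1.
cHeight-odd : ∀ m → cHeight (suc (double m)) ≡ suc (double m)
cHeight-odd m rewrite odd-double m = refl

cHeight-even : ∀ m → cHeight (suc (suc (double m))) ≡ suc (double m)
cHeight-even m rewrite odd-double m = refl

cHeight-tile : ∀ j → ∃ λ m → cHeight (suc j) ≡ suc (double m)
cHeight-tile j with parity j
... | twice m   = m , cHeight-odd m
... | twice+1 m = m , cHeight-even m

-- sv i, tv i and cv i are the paper's s_{i+1}, t_{i+1} and the contracted vertex at height 2i+1.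
sv tv cv : ℕ → V
sv i = (W , double i)
tv i = (E , double i)
cv i = (W , suc (double i))

sv-injective : ∀ {i j} → sv i ≡ sv j → i ≡ j
sv-injective = double-injective ∘ cong proj₂

tv-injective : ∀ {i j} → tv i ≡ tv j → i ≡ j
tv-injective = double-injective ∘ cong proj₂

cv-injective : ∀ {i j} → cv i ≡ cv j → i ≡ j
cv-injective = double-injective ∘ suc-injective ∘ cong proj₂

sv≢cv : ∀ {i j} → sv i ≢ cv j
sv≢cv {i} {j} = double≢1+double i j ∘ cong proj₂

contracted-double : ∀ n i → contracted n (double i) ≡ false
contracted-double n i = Equivalence.to T-not-≡ (T-not⁺ no-tile)
  where
  no-tile : ¬ T (contracted n (double i))
  no-tile t with satisfied (Anyₚ.map⁻ (any⁻ _ (tiles n) t))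
  ... | j , cHeight≡ᵇ with cHeight-tile j
  ...   | m , cHeight≡ = double≢1+double i m (trans (sym (≡ᵇ⇒≡ _ _ cHeight≡ᵇ)) cHeight≡)

canon-W : ∀ n y → canon n (W , y) ≡ (W , y)
canon-W n y with contracted n y
... | true  = refl
... | false = refl

canon-E : ∀ n i → canon n (E , double i) ≡ tv i
canon-E n i rewrite contracted-double n i = refl

oddTileArrows evenTileArrows : ℕ → List (V × V)
oddTileArrows  i = (sv i , tv i) ∷ (sv i , cv i) ∷ (cv i , tv i) ∷ []
evenTileArrows i = (sv (suc i) , tv (suc i)) ∷ (sv (suc i) , cv i) ∷ (cv i , tv (suc i)) ∷ []

tileArrows-odd : ∀ n i → tileArrows n (suc (double i)) ≡ oddTileArrows i
tileArrows-odd n i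
  rewrite odd-double i | canon-W n (double i) | canon-E n i | canon-W n (suc (double i)) = refl

tileArrows-even : ∀ n i → tileArrows n (suc (suc (double i))) ≡ evenTileArrows i
tileArrows-even n i
  rewrite odd-double i | canon-W n (suc (suc (double i))) | canon-E n (suc i) | canon-W n (suc (double i)) = refl

==V⇔≡ : ∀ {u v} → T (u ==V v) ⇔ u ≡ v
==V⇔≡ {true  , y} {true  , y′} = mk⇔ (cong (true ,_) ∘ ≡ᵇ⇒≡ y y′) (λ { refl → ≡⇒≡ᵇ y y refl })
==V⇔≡ {false , y} {false , y′} = mk⇔ (cong (false ,_) ∘ ≡ᵇ⇒≡ y y′) (λ { refl → ≡⇒≡ᵇ y y refl })
==V⇔≡ {true  , y} {false , y′} = mk⇔ (λ ()) (λ ())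
==V⇔≡ {false , y} {true  , y′} = mk⇔ (λ ()) (λ ())

arrowMatch⇔≡ : ∀ {u v} (ab : V × V) → T ((proj₁ ab ==V u) ∧ (proj₂ ab ==V v)) ⇔ (u , v) ≡ ab
arrowMatch⇔≡ {u} {v} (a , b) = mk⇔
  (λ t → let ta , tb = Equivalence.to (T-∧ {a ==V u}) t
         in sym (cong₂ _,_ (Equivalence.to ==V⇔≡ ta) (Equivalence.to ==V⇔≡ tb)))
  (λ { refl → Equivalence.from (T-∧ {u ==V u} {v ==V v})
                (Equivalence.from (==V⇔≡ {u}) refl , Equivalence.from (==V⇔≡ {v}) refl) })

arrow→tile : ∀ {n u v} → T (arrow n u v) → ∃ λ j → j < n × (u , v) ∈ tileArrows n (suc j)
arrow→tile {n} t with find (Anyₚ.map⁻ (any⁻ _ (tiles n) t))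
... | j , j∈ , uv∈ = j , ∈-upTo⁻ j∈ , Equivalence.to (T-any⇔∈ arrowMatch⇔≡ _) uv∈

tile→arrow : ∀ {n u v j} → j < n → (u , v) ∈ tileArrows n (suc j) → T (arrow n u v)
tile→arrow j<n uv∈ =
  any⁺ _ (Anyₚ.map⁺ (lose (∈-upTo⁺ j<n) (Equivalence.from (T-any⇔∈ arrowMatch⇔≡ _) uv∈)))

isSource⁺ : ∀ {n v} → (∀ {u} → ¬ T (arrow n u v)) → T (isSource n v)
isSource⁺ {n} no-arrow = T-not⁺ (λ t → no-arrow (proj₂ (satisfied (any⁻ _ (vertices n) t))))

isSource⁻ : ∀ {n u v} → u ∈ vertices n → T (arrow n u v) → ¬ T (isSource n v)
isSource⁻ u∈ a = T-not⁻ (any⁺ _ (lose u∈ a))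

isSink⁺ : ∀ {n u} → (∀ {v} → ¬ T (arrow n u v)) → T (isSink n u)
isSink⁺ {n} no-arrow = T-not⁺ (λ t → no-arrow (proj₂ (satisfied (any⁻ _ (vertices n) t))))

isSink⁻ : ∀ {n u v} → v ∈ vertices n → T (arrow n u v) → ¬ T (isSink n u)
isSink⁻ v∈ a = T-not⁻ (any⁺ _ (lose v∈ a))

Path-step↔ : ∀ {n u v} → u ≢ v → Path n u v ↔ (∃ λ w → T (arrow n u w) × Path n w v)
Path-step↔ {n} u≢v = mk↔ₛ′ (to u≢v) from (λ _ → refl) (from∘to u≢v)
  where
  to : ∀ {u v} → u ≢ v → Path n u v → ∃ λ w → T (arrow n u w) × Path n w v
  to u≢v here       = ⊥-elim (u≢v refl)
  to _   (step a p) = _ , a , p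
  from : ∀ {u v} → (∃ λ w → T (arrow n u w) × Path n w v) → Path n u v
  from (_ , a , p) = step a p
  from∘to : ∀ {u v} (u≢v : u ≢ v) (p : Path n u v) → from (to u≢v p) ≡ p
  from∘to u≢v here       = ⊥-elim (u≢v refl)
  from∘to _   (step a p) = refl

Path-sink↔ : ∀ {n u v} → (∀ {w} → ¬ T (arrow n u w)) → Path n u v ↔ (u ≡ v)
Path-sink↔ {n} sink = mk↔ₛ′ (to sink) from (λ { refl → refl }) (from∘to sink)
  where
  to : ∀ {u v} → (∀ {w} → ¬ T (arrow n u w)) → Path n u v → u ≡ v
  to _    here       = refl
  to sink (step a _) = ⊥-elim (sink a)
  from : ∀ {u v} → u ≡ v → Path n u v
  from refl = here
  from∘to : ∀ {u v} (sink : ∀ {w} → ¬ T (arrow n u w)) (p : Path n u v) → from (to sink p) ≡ p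
  from∘to _    here       = refl
  from∘to sink (step a _) = ⊥-elim (sink a)

-- The numbers of paths c_i ⇝ t_b, c_{a-1} ⇝ t_b (none if a = 0) and s_a ⇝ t_b.
pathsᶜ : ℕ → ℕ → ℕ
pathsᶜ i b = δ i b + δ (suc i) b

pathsᶜ↓ : ℕ → ℕ → ℕ
pathsᶜ↓ zero    b = 0
pathsᶜ↓ (suc i) b = pathsᶜ i b

pathsˢ : ℕ → ℕ → ℕ
pathsˢ a b = δ a b + (pathsᶜ a b + pathsᶜ↓ a b)

pathsˢ≡claimedEntry : ∀ {k} (i j : Fin k) → pathsˢ (toℕ i) (toℕ j) ≡ claimedEntry i j
pathsˢ≡claimedEntry zero                zero                = refl
pathsˢ≡claimedEntry zero                (suc zero)          = refl
pathsˢ≡claimedEntry zero                (suc (suc j))       = refl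
pathsˢ≡claimedEntry (suc zero)          zero                = refl
pathsˢ≡claimedEntry (suc (suc i))       zero                = refl
pathsˢ≡claimedEntry (suc zero)          (suc zero)          = refl
pathsˢ≡claimedEntry (suc zero)          (suc (suc zero))    = refl
pathsˢ≡claimedEntry (suc zero)          (suc (suc (suc j))) = refl
pathsˢ≡claimedEntry (suc (suc zero))    (suc zero)          = refl
pathsˢ≡claimedEntry (suc (suc (suc i))) (suc zero)          = refl
pathsˢ≡claimedEntry (suc (suc i))       (suc (suc j))       = pathsˢ≡claimedEntry (suc i) (suc j)

cv↓ : ℕ → List V
cv↓ zero    = []
cv↓ (suc i) = cv i ∷ []

module Ladder (h : ℕ) where

  n : ℕ
  n = suc (double h)

  contracted-odd : ∀ {i} → i ≤ h → contracted n (suc (double i)) ≡ true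
  contracted-odd {i} i≤h =
    Equivalence.to T-≡ (any⁺ _ (Anyₚ.map⁺ (lose (∈-upTo⁺ (s≤s (double-mono-≤ i≤h))) own-tile)))
    where
    own-tile : T (cHeight (suc (double i)) ≡ᵇ suc (double i))
    own-tile rewrite cHeight-odd i = ≡⇒≡ᵇ (suc (double i)) _ refl

  data Edge : V → V → Set where
    s→t  : ∀ {i} → i ≤ h → Edge (sv i) (tv i)
    s→c  : ∀ {i} → i ≤ h → Edge (sv i) (cv i)
    c→t  : ∀ {i} → i ≤ h → Edge (cv i) (tv i)
    s→c′ : ∀ {i} → i < h → Edge (sv (suc i)) (cv i)
    c→t′ : ∀ {i} → i < h → Edge (cv i) (tv (suc i))

  oddTile→Edge : ∀ {i u v} → i ≤ h → (u , v) ∈ oddTileArrows i → Edge u v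
  oddTile→Edge i≤h (here refl)                 = s→t i≤h
  oddTile→Edge i≤h (there (here refl))         = s→c i≤h
  oddTile→Edge i≤h (there (there (here refl))) = c→t i≤h

  evenTile→Edge : ∀ {i u v} → i < h → (u , v) ∈ evenTileArrows i → Edge u v
  evenTile→Edge i<h (here refl)                 = s→t i<h
  evenTile→Edge i<h (there (here refl))         = s→c′ i<h
  evenTile→Edge i<h (there (there (here refl))) = c→t′ i<h

  arrow→Edge : ∀ {u v} → T (arrow n u v) → Edge u v
  arrow→Edge t with arrow→tile t
  ... | j , j<n , uv∈ with parity j
  ...   | twice i   = oddTile→Edge (double-cancel-≤ (≤-pred j<n)) (subst (_ ∈_) (tileArrows-odd n i) uv∈)
  ...   | twice+1 i = evenTile→Edge (double-cancel-< (≤-pred j<n)) (subst (_ ∈_) (tileArrows-even n i) uv∈)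

  oddTile→arrow : ∀ {i u v} → i ≤ h → (u , v) ∈ oddTileArrows i → T (arrow n u v)
  oddTile→arrow i≤h = tile→arrow (s≤s (double-mono-≤ i≤h)) ∘ subst (_ ∈_) (sym (tileArrows-odd n _))

  evenTile→arrow : ∀ {i u v} → i < h → (u , v) ∈ evenTileArrows i → T (arrow n u v)
  evenTile→arrow i<h = tile→arrow (s≤s (<⇒≤ (double-mono-≤ i<h))) ∘ subst (_ ∈_) (sym (tileArrows-even n _))

  Edge→arrow : ∀ {u v} → Edge u v → T (arrow n u v)
  Edge→arrow (s→t  i≤h) = oddTile→arrow  i≤h (here refl)
  Edge→arrow (s→c  i≤h) = oddTile→arrow  i≤h (there (here refl))
  Edge→arrow (c→t  i≤h) = oddTile→arrow  i≤h (there (there (here refl)))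
  Edge→arrow (s→c′ i<h) = evenTile→arrow i<h (there (here refl))
  Edge→arrow (c→t′ i<h) = evenTile→arrow i<h (there (there (here refl)))

  ¬Edge-from-tv : ∀ {i w} → ¬ Edge (tv i) w
  ¬Edge-from-tv ()

  ¬Edge-into-sv : ∀ {u v i} → Edge u v → v ≢ sv i
  ¬Edge-into-sv (s→t  _) ()
  ¬Edge-into-sv (s→c  _) v≡sv = sv≢cv (sym v≡sv)
  ¬Edge-into-sv (c→t  _) ()
  ¬Edge-into-sv (s→c′ _) v≡sv = sv≢cv (sym v≡sv)
  ¬Edge-into-sv (c→t′ _) ()

  Edge-from-cv : ∀ {u w i} → Edge u w → u ≡ cv i → w ∈ tv i ∷ tv (suc i) ∷ []
  Edge-from-cv (s→t  _) u≡cv = ⊥-elim (sv≢cv u≡cv)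
  Edge-from-cv (s→c  _) u≡cv = ⊥-elim (sv≢cv u≡cv)
  Edge-from-cv (c→t  _) u≡cv = here (cong tv (cv-injective u≡cv))
  Edge-from-cv (s→c′ _) u≡cv = ⊥-elim (sv≢cv u≡cv)
  Edge-from-cv (c→t′ _) u≡cv = there (here (cong (tv ∘ suc) (cv-injective u≡cv)))

  Edge-from-sv : ∀ {u w a} → Edge u w → u ≡ sv a → w ∈ tv a ∷ cv a ∷ cv↓ a
  Edge-from-sv (s→t  _) u≡sv = here (cong tv (sv-injective u≡sv))
  Edge-from-sv (s→c  _) u≡sv = there (here (cong cv (sv-injective u≡sv)))
  Edge-from-sv (c→t  _) u≡sv = ⊥-elim (sv≢cv (sym u≡sv))
  Edge-from-sv (s→c′ _) u≡sv with sv-injective u≡sv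
  ... | refl = there (there (here refl))
  Edge-from-sv (c→t′ _) u≡sv = ⊥-elim (sv≢cv (sym u≡sv))

  tv-noArrow : ∀ {i w} → ¬ T (arrow n (tv i) w)
  tv-noArrow = ¬Edge-from-tv ∘ arrow→Edge

  paths-tv : ∀ i b → Path n (tv i) (tv b) ↔ Fin (δ i b)
  paths-tv i b = ↔-trans (Path-sink↔ tv-noArrow)
                         (↔-trans (irrelevant-⇔⇒↔ uip ≡-irrelevant (mk⇔ tv-injective (cong tv))) ≡↔Fin-δ)

  reaches-tv : ∀ {i b} → Path n (tv i) (tv b) → i ≡ b
  reaches-tv = tv-injective ∘ Inverse.to (Path-sink↔ tv-noArrow)

  -- The arrow c_i → t_{i+1} is missing when i = h, but then t_{i+1} reaches no sink t_b.
  cv-out : ∀ {i b w} → i ≤ h → b ≤ h → Path n w (tv b) → T (arrow n (cv i) w) ⇔ w ∈ tv i ∷ tv (suc i) ∷ []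
  cv-out i≤h b≤h p = mk⇔ (λ a → Edge-from-cv (arrow→Edge a) refl) (from p)
    where
    from : ∀ {w} → Path n w (tv _) → w ∈ tv _ ∷ tv (suc _) ∷ [] → T (arrow n (cv _) w)
    from _ (here refl)         = Edge→arrow (c→t i≤h)
    from p (there (here refl)) = Edge→arrow (c→t′ (subst (_≤ h) (sym (reaches-tv p)) b≤h))

  paths-cv : ∀ {i b} → i ≤ h → b ≤ h → Path n (cv i) (tv b) ↔ Fin (pathsᶜ i b)
  paths-cv {i} {b} i≤h b≤h =
    ↔-trans (Path-step↔ (λ ()))
    (↔-trans (Σ-neighbours↔Any _ tv-distinct T-irrelevant (cv-out i≤h b≤h))
             (Any-∷↔Fin (paths-tv i b) (↔-trans Any-[x]↔ (paths-tv (suc i) b))))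
    where
    tv-distinct : Unique (tv i ∷ tv (suc i) ∷ [])
    tv-distinct = ((λ e → 1+n≢n (sym (tv-injective e))) ∷ []) ∷ [] ∷ []

  sv-out : ∀ {a w} → a ≤ h → T (arrow n (sv a) w) ⇔ w ∈ tv a ∷ cv a ∷ cv↓ a
  sv-out {a} a≤h = mk⇔ (λ t → Edge-from-sv (arrow→Edge t) refl) (Edge→arrow ∘ from a≤h)
    where
    from : ∀ {a w} → a ≤ h → w ∈ tv a ∷ cv a ∷ cv↓ a → Edge (sv a) w
    from         a≤h (here refl)                 = s→t a≤h
    from         a≤h (there (here refl))         = s→c a≤h
    from {suc i} a≤h (there (there (here refl))) = s→c′ a≤h

  paths-cv↓ : ∀ {a b} → a ≤ h → b ≤ h → Any (λ w → Path n w (tv b)) (cv↓ a) ↔ Fin (pathsᶜ↓ a b)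
  paths-cv↓ {zero}  _   _   = Any-[]↔Fin
  paths-cv↓ {suc i} a≤h b≤h = ↔-trans Any-[x]↔ (paths-cv (<⇒≤ a≤h) b≤h)

  paths-sv : ∀ {a b} → a ≤ h → b ≤ h → Path n (sv a) (tv b) ↔ Fin (pathsˢ a b)
  paths-sv {a} {b} a≤h b≤h =
    ↔-trans (Path-step↔ (λ ()))
    (↔-trans (Σ-neighbours↔Any _ (out-distinct a) T-irrelevant (λ _ → sv-out a≤h))
             (Any-∷↔Fin (paths-tv a b) (Any-∷↔Fin (paths-cv a≤h b≤h) (paths-cv↓ a≤h b≤h))))
    where
    out-distinct : ∀ a → Unique (tv a ∷ cv a ∷ cv↓ a)
    out-distinct zero    = ((λ ()) ∷ []) ∷ [] ∷ []
    out-distinct (suc i) = ((λ ()) ∷ (λ ()) ∷ []) ∷ ((λ e → 1+n≢n (cv-injective e)) ∷ []) ∷ [] ∷ []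

  heightVertices : ℕ → List V
  heightVertices y = if contracted n y then (W , y) ∷ [] else (W , y) ∷ (E , y) ∷ []

  block : ℕ → List V
  block i = sv i ∷ tv i ∷ cv i ∷ []

  heightVertices-block : ∀ {i} → i ≤ h → heightVertices (double i) ++ heightVertices (suc (double i)) ≡ block i
  heightVertices-block {i} i≤h rewrite contracted-double n i | contracted-odd i≤h = refl

  concatMap-blocks : ∀ c (f : ℕ → ℕ) → (∀ i → i < c → f i ≤ h) →
                     concatMap heightVertices (concat (applyUpTo (λ i → double (f i) ∷ suc (double (f i)) ∷ []) c))
                       ≡ concatMap block (applyUpTo f c)
  concatMap-blocks zero    f _     = refl
  concatMap-blocks (suc c) f bound =
    trans (sym (++-assoc (heightVertices (double (f 0))) (heightVertices (suc (double (f 0)))) _))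
          (cong₂ _++_ (heightVertices-block (bound 0 z<s))
                      (concatMap-blocks c (f ∘ suc) (λ i i<c → bound (suc i) (s<s i<c))))

  vertices≡ : vertices n ≡ concatMap block (upTo (suc h))
  vertices≡ = trans (cong (concatMap heightVertices) (applyUpTo-double id (suc h)))
                    (concatMap-blocks (suc h) id (λ _ → ≤-pred))

  block⊆vertices : ∀ {i v} → i ≤ h → v ∈ block i → v ∈ vertices n
  block⊆vertices i≤h v∈ = subst (_ ∈_) (sym vertices≡) (∈-concatMap⁺ block (lose (∈-upTo⁺ (s≤s i≤h)) v∈))

  sources-block : ∀ {i} → i ≤ h → filterᵇ (isSource n) (block i) ≡ sv i ∷ []
  sources-block {i} i≤h =
    trans (filter-accept (T? ∘ isSource n) (isSource⁺ {n} (λ t → ¬Edge-into-sv (arrow→Edge t) refl)))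
          (cong (sv i ∷_) (trans (filter-reject (T? ∘ isSource n) (isSource⁻ {n} sv∈ (Edge→arrow (s→t i≤h))))
                                 (filter-reject (T? ∘ isSource n) (isSource⁻ {n} sv∈ (Edge→arrow (s→c i≤h))))))
    where
    sv∈ : sv i ∈ vertices n
    sv∈ = block⊆vertices i≤h (here refl)

  sinks-block : ∀ {i} → i ≤ h → filterᵇ (isSink n) (block i) ≡ tv i ∷ []
  sinks-block {i} i≤h =
    trans (filter-reject (T? ∘ isSink n) (isSink⁻ {n} tv∈ (Edge→arrow (s→t i≤h))))
          (trans (filter-accept (T? ∘ isSink n) (isSink⁺ {n} tv-noArrow))
                 (cong (tv i ∷_) (filter-reject (T? ∘ isSink n) (isSink⁻ {n} tv∈ (Edge→arrow (c→t i≤h))))))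
    where
    tv∈ : tv i ∈ vertices n
    tv∈ = block⊆vertices i≤h (there (here refl))

  sources≡ : sources n ≡ applyUpTo sv (suc h)
  sources≡ = trans (cong (filterᵇ (isSource n)) vertices≡)
                   (filterᵇ-concatMap (isSource n) block sv (suc h) id (λ _ → sources-block ∘ ≤-pred))

  sinks≡ : sinks n ≡ applyUpTo tv (suc h)
  sinks≡ = trans (cong (filterᵇ (isSink n)) vertices≡)
                 (filterᵇ-concatMap (isSink n) block tv (suc h) id (λ _ → sinks-block ∘ ≤-pred))

  length-sources : length (sources n) ≡ suc h
  length-sources = trans (cong length sources≡) (length-applyUpTo sv (suc h))

  length-sinks : length (sinks n) ≡ suc h
  length-sinks = trans (cong length sinks≡) (length-applyUpTo tv (suc h))

  pathMatrix : (i j : Fin (suc h)) →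
               Path n (lookup (sources n) (cast (sym length-sources) i)) (lookup (sinks n) (cast (sym length-sinks) j))
                 ↔ Fin (claimedEntry i j)
  pathMatrix i j =
    subst₂ (λ u v → Path n u v ↔ Fin (claimedEntry i j))
           (sym (lookup-cast-applyUpTo sv (suc h) sources≡ length-sources i))
           (sym (lookup-cast-applyUpTo tv (suc h) sinks≡ length-sinks j))
           (subst (λ c → Path n (sv (toℕ i)) (tv (toℕ j)) ↔ Fin c) (pathsˢ≡claimedEntry i j)
                  (paths-sv (≤-pred (toℕ<n i)) (≤-pred (toℕ<n j))))

proposition4p4 : (k : ℕ) → 1 ≤ k →
    Σ (length (sources (2 * k ∸ 1)) ≡ k) λ eqs →
    Σ (length (sinks (2 * k ∸ 1)) ≡ k) λ eqt →
      ((i j : Fin k) →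
        Path (2 * k ∸ 1) (lookup (sources (2 * k ∸ 1)) (cast (sym eqs) i))
                         (lookup (sinks (2 * k ∸ 1)) (cast (sym eqt) j))
          ↔ Fin (claimedEntry i j))
      × (det {k} (λ i j → + claimedEntry i j) ≡ + fib (suc (2 * k)))
proposition4p4 (suc h) _ = at-double (2 * suc h) (sym (double≡2* (suc h)))
  where
  open Ladder h
  -- 2 * k is abstracted because the goal only exposes it in normalised form.
  at-double : ∀ d → d ≡ double (suc h) →
    Σ (length (sources (d ∸ 1)) ≡ suc h) λ eqs →
    Σ (length (sinks (d ∸ 1)) ≡ suc h) λ eqt →
      ((i j : Fin (suc h)) →
        Path (d ∸ 1) (lookup (sources (d ∸ 1)) (cast (sym eqs) i)) (lookup (sinks (d ∸ 1)) (cast (sym eqt) j))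
          ↔ Fin (claimedEntry i j))
      × (det {suc h} (λ i j → + claimedEntry i j) ≡ + fib (suc d))
  at-double _ refl = length-sources , length-sinks , pathMatrix , det-claimedEntry h
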